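{- Let $G$ and $H$ be graphs with $\mathrm{oh}(G)=s\geq 2$ and $\mathrm{oh}(H)=t\geq 2$. If $\ast$ is either the lexicographic product or the strong product $\boxtimes$, then $\mathrm{oh}(G\ast H)\geq st$.
   Context: All graphs are finite, simple and loopless. $\mathrm{oh}(G)$ (Odd Hadwiger number) is the largest integer $m$ for which there exist $m$ pairwise vertex-disjoint trees $Z_1,\dots,Z_m$ in $G$ and a 2-colouring $c$ of $V(Z_1)\cup\dots\cup V(Z_m)$ that is proper on each $Z_k$, such that for every $k\neq k'$ there is an edge $xy\in E(G)$ with $x\in V(Z_k)$, $y\in V(Z_{k'})$, $c(x)=c(y)$. Both products have vertex set $V(G)\times V(H)$. Lexicographic product: $(v_1,u_1)\sim(v_2,u_2)$ iff $v_1v_2\in E(G)$, or ($v_1=v_2$ and $u_1u_2\in E(H)$). Strong product: $(v_1,u_1)\sim(v_2,u_2)$ iff ($v_1=v_2$ and $u_1u_2\in E(H)$), or ($u_1=u_2$ and $v_1v_2\in E(G)$), or ($v_1v_2\in E(G)$ and $u_1u_2\in E(H)$). -}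

module Defs where

open import Data.Nat using (ℕ; _≤_; _*_)
open import Data.Fin using (Fin)
open import Data.Bool using (Bool)
open import Data.List using (List; []; _∷_; _++_; [_]; length)
open import Data.List.Membership.Propositional using (_∈_)
open import Data.List.Relation.Unary.Unique.Propositional using (Unique)
open import Data.List.Relation.Unary.Linked using (Linked)
open import Data.Product using (Σ; _×_; _,_; ∃; ∃-syntax)
open import Data.Sum using (_⊎_; inj₁; inj₂)
open import Data.Empty using (⊥)
open import Relation.Nullary using (¬_)
open import Relation.Binary.PropositionalEquality using (_≡_; _≢_; refl; sym)
open import Relation.Binary.Construct.Closure.ReflexiveTransitive using (Star)

-- A (simple, loopless) graph on vertex type V: symmetric irreflexive adjacency.
-- Finite graphs are obtained by taking V = Fin n.
record Graph (V : Set) : Set₁ where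
  field
    E      : V → V → Set
    E-sym  : ∀ {x y} → E x y → E y x
    E-irr  : ∀ {x} → ¬ E x x
open Graph public

record Tree {V : Set} (G : Graph V) : Set₁ where
  field
    verts     : List V
    root      : V
    root∈     : root ∈ verts
    distinct  : Unique verts
    T         : V → V → Set
    T⊆E       : ∀ {x y} → T x y → E G x y
    T-sym     : ∀ {x y} → T x y → T y x
    T-verts   : ∀ {x y} → T x y → (x ∈ verts) × (y ∈ verts)
    connected : ∀ {x y} → x ∈ verts → y ∈ verts → Star T x y
    acyclic   : ∀ (x : V) (xs : List V) → 2 ≤ length xs → Unique (x ∷ xs) →
                ¬ Linked T (x ∷ xs ++ [ x ])
open Tree public

-- G has an odd clique minor of size m, witnessed by trees Z₁ … Z_m and a
-- 2-colouring c (only its values on the trees matter).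
HasOddKm : ∀ {V : Set} → Graph V → ℕ → Set₁
HasOddKm {V} G m =
  Σ (Fin m → Tree G) λ Z →
  Σ (V → Bool) λ c →
    (∀ k {x y} → T (Z k) x y → c x ≢ c y)
  × (∀ k k' → k ≢ k' → ∀ v → v ∈ verts (Z k) → v ∈ verts (Z k') → ⊥)
  × (∀ k k' → k ≢ k' →
       ∃[ x ] ∃[ y ] (x ∈ verts (Z k)) × (y ∈ verts (Z k')) × E G x y × (c x ≡ c y))

IsOh : ∀ {V : Set} → Graph V → ℕ → Set₁
IsOh G s = HasOddKm G s × (∀ m → HasOddKm G m → m ≤ s)

lex : ∀ {A B : Set} → Graph A → Graph B → Graph (A × B)
lex {A} {B} G H = record { E = e ; E-sym = s ; E-irr = i }
  where
  e : A × B → A × B → Set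
  e (v₁ , u₁) (v₂ , u₂) = E G v₁ v₂ ⊎ (v₁ ≡ v₂ × E H u₁ u₂)
  s : ∀ {x y} → e x y → e y x
  s (inj₁ p) = inj₁ (E-sym G p)
  s (inj₂ (refl , q)) = inj₂ (refl , E-sym H q)
  i : ∀ {x} → ¬ e x x
  i (inj₁ p) = E-irr G p
  i (inj₂ (_ , q)) = E-irr H q

strong : ∀ {A B : Set} → Graph A → Graph B → Graph (A × B)
strong {A} {B} G H = record { E = e ; E-sym = s ; E-irr = i }
  where
  e : A × B → A × B → Set
  e (v₁ , u₁) (v₂ , u₂) =
    (v₁ ≡ v₂ × E H u₁ u₂) ⊎ (u₁ ≡ u₂ × E G v₁ v₂) ⊎ (E G v₁ v₂ × E H u₁ u₂)
  s : ∀ {x y} → e x y → e y x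
  s (inj₁ (refl , q)) = inj₁ (refl , E-sym H q)
  s (inj₂ (inj₁ (refl , p))) = inj₂ (inj₁ (refl , E-sym G p))
  s (inj₂ (inj₂ (p , q))) = inj₂ (inj₂ (E-sym G p , E-sym H q))
  i : ∀ {x} → ¬ e x x
  i (inj₁ (_ , q)) = E-irr H q
  i (inj₂ (inj₁ (_ , p))) = E-irr G p
  i (inj₂ (inj₂ (p , _))) = E-irr G p

{-# OPTIONS --safe #-}
module Submission where

-- Let (Zᵢ, c) be an odd Kₛ minor of G and (Wⱼ, d) an odd Kₜ minor of H.  For every pair
-- (i, j) take in G ⊠ H the comb Yᵢⱼ on Zᵢ × Wⱼ: the spine {root Zᵢ} × Wⱼ with a copy
-- Zᵢ × {u} of Zᵢ hanging from every spine vertex (root Zᵢ , u), and colour (v , u) by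
-- c v xor d u.  Spine edges change only d and teeth change only c, so the colouring is proper
-- on every comb.  Two combs with different i are separated by G, with different j by H.  A
-- monochromatic edge between Yᵢⱼ and Yᵢ'ⱼ' is a G-contact edge inside a common row if j = j',
-- an H-contact edge between the spines if i = i', and otherwise the diagonal edge formed from a
-- G- and an H-contact edge.  Since G ⊠ H is a spanning subgraph of G[H], the same minor lives
-- in the lexicographic product.

open import Defs
open import Data.Nat using (ℕ; _≤_; _*_)
open import Data.Fin using (Fin; remQuot; combine)
open import Data.Fin.Properties using (combine-remQuot) renaming (_≟_ to _≟ᶠ_)
open import Data.Bool using (Bool; true; false; _xor_)
open import Data.Bool.Properties using (not-injective; xor-comm)
open import Data.Sum using (inj₁; inj₂)
open import Data.Product using (_×_; _,_; proj₁; proj₂; ∃-syntax; uncurry)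
open import Data.Product.Properties using (≡-dec)
open import Data.Empty using (⊥; ⊥-elim)
open import Data.List using (List; []; _∷_; _++_; [_]; length; map; cartesianProduct)
open import Data.List.Properties using (map-++; length-map; ++-assoc)
open import Data.List.Membership.Propositional using (_∈_; find)
open import Data.List.Membership.Propositional.Properties
  using (∈-cartesianProduct⁺; ∈-cartesianProduct⁻; ∈-++⁺ˡ; ∈-++⁺ʳ; ∈-++⁻; ∈-∃++)
open import Data.List.Relation.Unary.Any using (here; there)
import Data.List.Relation.Unary.Any as Any
open import Data.List.Relation.Unary.All using (All; []; _∷_; all?)
import Data.List.Relation.Unary.All as All
open import Data.List.Relation.Unary.All.Properties using (¬Any⇒All¬; ¬All⇒Any¬)
import Data.List.Relation.Unary.All.Properties as All
open import Data.List.Relation.Unary.Unique.Propositional using (Unique; []; _∷_)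
import Data.List.Relation.Unary.Unique.Propositional as Unique
open import Data.List.Relation.Unary.Unique.Propositional.Properties using (cartesianProduct⁺)
open import Data.List.Relation.Unary.Linked using (Linked; []; [-]; _∷_)
import Data.List.Relation.Unary.Linked as Linked
open import Function using (_∘_)
open import Relation.Nullary using (¬_; Dec; yes; no; does)
open import Relation.Nullary.Decidable using (dec-true; dec-false)
open import Relation.Binary.Definitions using (DecidableEquality)
open import Relation.Binary.PropositionalEquality
  using (_≡_; _≢_; refl; sym; trans; cong; cong₂; subst; ≢-sym; module ≡-Reasoning)
open import Relation.Binary.Construct.Closure.ReflexiveTransitive using (Star; _◅◅_; gmap)

Acyclic : ∀ {V : Set} → (V → V → Set) → Set
Acyclic {V} T = ∀ (x : V) (xs : List V) → 2 ≤ length xs → Unique (x ∷ xs) →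
                ¬ Linked T (x ∷ xs ++ [ x ])

ProperOn : ∀ {V : Set} {G : Graph V} → (V → Bool) → Tree G → Set
ProperOn c Z = ∀ {x y} → T Z x y → c x ≢ c y

Disjoint : ∀ {V : Set} {G : Graph V} → Tree G → Tree G → Set
Disjoint Z Z' = ∀ v → v ∈ verts Z → v ∈ verts Z' → ⊥

OddContact : ∀ {V : Set} (G : Graph V) → (V → Bool) → Tree G → Tree G → Set
OddContact G c Z Z' =
  ∃[ x ] ∃[ y ] (x ∈ verts Z) × (y ∈ verts Z') × E G x y × (c x ≡ c y)

Pairwise : ∀ {V : Set} {G : Graph V} {m : ℕ} → (Tree G → Tree G → Set) → (Fin m → Tree G) → Set
Pairwise R Z = ∀ k k' → k ≢ k' → R (Z k) (Z k')

_⊆ᴱ_ : ∀ {V : Set} → Graph V → Graph V → Set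
G ⊆ᴱ G' = ∀ {x y} → E G x y → E G' x y

does-true⇒ : ∀ {P : Set} (P? : Dec P) → does P? ≡ true → P
does-true⇒ (yes p) _ = p

xor-cancelˡ : ∀ a {b b'} → a xor b ≡ a xor b' → b ≡ b'
xor-cancelˡ false e = e
xor-cancelˡ true  e = not-injective e

xor-cancelʳ : ∀ {a a'} b → a xor b ≡ a' xor b → a ≡ a'
xor-cancelʳ {a} {a'} b e = xor-cancelˡ b (trans (xor-comm b a) (trans e (xor-comm a' b)))

module _ {V : Set} {R : V → V → Set} where

  Linked-++⁻ˡ : ∀ xs {ys} → Linked R (xs ++ ys) → Linked R xs
  Linked-++⁻ˡ []           _       = []
  Linked-++⁻ˡ (x ∷ [])     _       = [-]
  Linked-++⁻ˡ (x ∷ y ∷ xs) (r ∷ l) = r ∷ Linked-++⁻ˡ (y ∷ xs) l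

  Linked-++⁻ʳ : ∀ xs {ys} → Linked R (xs ++ ys) → Linked R ys
  Linked-++⁻ʳ []       l = l
  Linked-++⁻ʳ (x ∷ xs) l = Linked-++⁻ʳ xs (Linked.tail l)

Unique-++-∷⁻ : ∀ {V : Set} {a : V} ys {zs} → Unique (ys ++ a ∷ zs) → All (a ≢_) ys × All (a ≢_) zs
Unique-++-∷⁻ []       (a≢ ∷ _) = [] , a≢
Unique-++-∷⁻ (y ∷ ys) (y≢ ∷ u) =
  let (ys≢ , zs≢) = Unique-++-∷⁻ ys u
  in ≢-sym (All.lookup y≢ (∈-++⁺ʳ ys (here refl))) ∷ ys≢ , zs≢

module _ {V X : Set} {R : V → V → Set} {P : V → Set} (f : V → X)
         (f-resp : ∀ {u w} → P u → P w → R u w → f u ≡ f w) where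

  Linked⇒≡-head : ∀ {w ws y} → Linked R (w ∷ ws) → All P (w ∷ ws) → y ∈ w ∷ ws → f y ≡ f w
  Linked⇒≡-head _       _         (here refl)  = refl
  Linked⇒≡-head (r ∷ l) (pw ∷ ps) (there y∈ws) =
    trans (Linked⇒≡-head l ps y∈ws) (sym (f-resp pw (All.head ps) r))

  Linked⇒≡ : ∀ {ws y z} → Linked R ws → All P ws → y ∈ ws → z ∈ ws → f y ≡ f z
  Linked⇒≡ {_ ∷ _} l ps y∈ z∈ = trans (Linked⇒≡-head l ps y∈) (sym (Linked⇒≡-head l ps z∈))

-- Deleting a from the cycle leaves a path, so f is constant on the remaining vertices.
module _ {V X : Set} (_≟_ : DecidableEquality V) {T : V → V → Set} (a : V) (f : V → X)
         (f-resp : ∀ {u w} → a ≢ u → a ≢ w → T u w → f u ≡ f w) where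

  private
    ≡-head-on-cycle-minus : ∀ {x xs y} → a ≢ x → Unique (x ∷ xs) → Linked T (x ∷ xs ++ [ x ]) →
                            y ∈ x ∷ xs → a ≢ y → f y ≡ f x
    ≡-head-on-cycle-minus {x} {xs} a≢x u l y∈ a≢y with Any.any? (a ≟_) xs
    ... | no a∉xs =
      Linked⇒≡ f f-resp (Linked-++⁻ˡ (x ∷ xs) l) (a≢x ∷ ¬Any⇒All¬ xs a∉xs) y∈ (here refl)
    ... | yes a∈xs with ys , zs , refl ← ∈-∃++ a∈xs = on-arcs y∈ a≢y
      where
      ys≢ : All (a ≢_) ys
      ys≢ = proj₁ (Unique-++-∷⁻ ys (Unique.tail u))
      zs≢ : All (a ≢_) zs
      zs≢ = proj₂ (Unique-++-∷⁻ ys (Unique.tail u))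
      l' : Linked T (x ∷ ys ++ a ∷ zs ++ [ x ])
      l' = subst (λ ws → Linked T (x ∷ ws)) (++-assoc ys (a ∷ zs) [ x ]) l
      arc₁ : Linked T (x ∷ ys)
      arc₁ = Linked-++⁻ˡ (x ∷ ys) l'
      arc₂ : Linked T (zs ++ [ x ])
      arc₂ = Linked.tail (Linked-++⁻ʳ (x ∷ ys) l')
      on-arcs : ∀ {y} → y ∈ x ∷ ys ++ a ∷ zs → a ≢ y → f y ≡ f x
      on-arcs (here refl) _ = refl
      on-arcs (there y∈) a≢y with ∈-++⁻ ys y∈
      ... | inj₁ y∈ys         = Linked⇒≡ f f-resp arc₁ (a≢x ∷ ys≢) (there y∈ys) (here refl)
      ... | inj₂ (here refl)  = ⊥-elim (a≢y refl)
      ... | inj₂ (there y∈zs) =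
        Linked⇒≡ f f-resp arc₂ (All.++⁺ zs≢ (a≢x ∷ [])) (∈-++⁺ˡ y∈zs) (∈-++⁺ʳ zs (here refl))

  ≡-on-cycle-minus : ∀ {x xs y z} → Unique (x ∷ xs) → Linked T (x ∷ xs ++ [ x ]) →
                     y ∈ x ∷ xs → z ∈ x ∷ xs → a ≢ y → a ≢ z → f y ≡ f z
  ≡-on-cycle-minus {x} {xs} u l y∈ z∈ a≢y a≢z with a ≟ x
  ... | no a≢x =
    trans (≡-head-on-cycle-minus a≢x u l y∈ a≢y) (sym (≡-head-on-cycle-minus a≢x u l z∈ a≢z))
  ... | yes refl with a≢xs ∷ _ ← u =
    Linked⇒≡ f f-resp (Linked-++⁻ˡ xs (Linked.tail l)) a≢xs
      (Any.tail (≢-sym a≢y) y∈) (Any.tail (≢-sym a≢z) z∈)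

module _ {V W : Set} {T : V → V → Set} {T' : W → W → Set} {P : V → Set} (g : V → W)
         (g-injective : ∀ {y z} → P y → P z → g y ≡ g z → y ≡ z)
         (g-hom : ∀ {y z} → P y → P z → T y z → T' (g y) (g z)) where

  private
    map-Linked : ∀ {ys} → All P ys → Linked T ys → Linked T' (map g ys)
    map-Linked []           []      = []
    map-Linked (_ ∷ [])     [-]     = [-]
    map-Linked (p ∷ q ∷ ps) (t ∷ l) = g-hom p q t ∷ map-Linked (q ∷ ps) l

    map-Unique : ∀ {ys} → All P ys → Unique ys → Unique (map g ys)
    map-Unique []       []        = []
    map-Unique (p ∷ ps) (y≢ ∷ u) =
      All.map⁺ (All.zipWith (λ (q , y≢z) → y≢z ∘ g-injective p q) (ps , y≢)) ∷ map-Unique ps u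

  Acyclic-pullback : Acyclic T' → ∀ x xs → 2 ≤ length xs → Unique (x ∷ xs) →
                     Linked T (x ∷ xs ++ [ x ]) → ¬ All P (x ∷ xs)
  Acyclic-pullback acyclic' x xs 2≤∣xs∣ u l ps@(px ∷ pxs) =
    acyclic' (g x) (map g xs) (subst (2 ≤_) (sym (length-map g xs)) 2≤∣xs∣) (map-Unique ps u)
      (subst (λ ws → Linked T' (g x ∷ ws)) (map-++ g xs [ x ])
        (map-Linked (px ∷ All.++⁺ pxs (px ∷ [])) l))

module _ {A B : Set} (G : Graph A) (H : Graph B) where

  strong-vertical : ∀ {v u u'} → E H u u' → E (strong G H) (v , u) (v , u')
  strong-vertical e = inj₁ (refl , e)

  strong-horizontal : ∀ {v v' u} → E G v v' → E (strong G H) (v , u) (v' , u)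
  strong-horizontal e = inj₂ (inj₁ (refl , e))

  strong-diagonal : ∀ {v v' u u'} → E G v v' → E H u u' → E (strong G H) (v , u) (v' , u')
  strong-diagonal e f = inj₂ (inj₂ (e , f))

  strong⊆lex : strong G H ⊆ᴱ lex G H
  strong⊆lex (inj₁ (refl , e))     = inj₂ (refl , e)
  strong⊆lex (inj₂ (inj₁ (_ , e))) = inj₁ e
  strong⊆lex (inj₂ (inj₂ (e , _))) = inj₁ e

module Comb {A B : Set} (_≟ᴬ_ : DecidableEquality A) (_≟ᴮ_ : DecidableEquality B)
            {G : Graph A} {H : Graph B} (Z : Tree G) (W : Tree H) where

  r : A
  r = root Z

  data CombEdge : A × B → A × B → Set where
    spine : ∀ {u u'} → T W u u' → CombEdge (r , u) (r , u')
    tooth : ∀ {v v' u} → u ∈ verts W → T Z v v' → CombEdge (v , u) (v' , u)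

  comb-verts : List (A × B)
  comb-verts = cartesianProduct (verts Z) (verts W)

  CombEdge⊆strong : ∀ {x y} → CombEdge x y → E (strong G H) x y
  CombEdge⊆strong (spine e)   = strong-vertical G H (T⊆E W e)
  CombEdge⊆strong (tooth _ e) = strong-horizontal G H (T⊆E Z e)

  CombEdge-sym : ∀ {x y} → CombEdge x y → CombEdge y x
  CombEdge-sym (spine e)    = spine (T-sym W e)
  CombEdge-sym (tooth u∈ e) = tooth u∈ (T-sym Z e)

  CombEdge-verts : ∀ {x y} → CombEdge x y → (x ∈ comb-verts) × (y ∈ comb-verts)
  CombEdge-verts (spine e) =
    ∈-cartesianProduct⁺ (root∈ Z) (proj₁ (T-verts W e)) ,
    ∈-cartesianProduct⁺ (root∈ Z) (proj₂ (T-verts W e))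
  CombEdge-verts (tooth u∈ e) =
    ∈-cartesianProduct⁺ (proj₁ (T-verts Z e)) u∈ ,
    ∈-cartesianProduct⁺ (proj₂ (T-verts Z e)) u∈

  comb-connected : ∀ {x y} → x ∈ comb-verts → y ∈ comb-verts → Star CombEdge x y
  comb-connected {v , u} {v' , u'} x∈ y∈
    with v∈ , u∈ ← ∈-cartesianProduct⁻ (verts Z) (verts W) x∈
       | v'∈ , u'∈ ← ∈-cartesianProduct⁻ (verts Z) (verts W) y∈ =
    gmap (_, u) (tooth u∈) (connected Z v∈ (root∈ Z)) ◅◅
    gmap (r ,_) spine (connected W u∈ u'∈) ◅◅
    gmap (_, u') (tooth u'∈) (connected Z (root∈ Z) v'∈)

  OnSpine : A × B → Set
  OnSpine p = proj₁ p ≡ r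

  InRow : B → A × B → Set
  InRow u₀ p = proj₂ p ≡ u₀

  private
    spine-injective : ∀ {p q} → OnSpine p → OnSpine q → proj₂ p ≡ proj₂ q → p ≡ q
    spine-injective refl refl refl = refl

    spine-hom : ∀ {p q} → OnSpine p → OnSpine q → CombEdge p q → T W (proj₂ p) (proj₂ q)
    spine-hom refl refl (spine e)   = e
    spine-hom refl refl (tooth _ e) = ⊥-elim (E-irr G (T⊆E Z e))

    on-spine? : ∀ p → Dec (OnSpine p)
    on-spine? p = proj₁ p ≟ᴬ r

    row-injective : ∀ {u₀ p q} → InRow u₀ p → InRow u₀ q → proj₁ p ≡ proj₁ q → p ≡ q
    row-injective refl refl refl = refl

    row-hom : ∀ {u₀ p q} → InRow u₀ p → InRow u₀ q → CombEdge p q → T Z (proj₁ p) (proj₁ q)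
    row-hom refl refl (tooth _ e) = e
    row-hom refl refl (spine e)   = ⊥-elim (E-irr H (T⊆E W e))

  -- Only spine edges leave a row, and the only spine vertex of row u₀ is (r , u₀), so a cycle
  -- through an off-spine vertex of row u₀ cannot leave that row.
  off-spine⇒InRow : ∀ {x xs v₀ u₀} → Unique (x ∷ xs) → Linked CombEdge (x ∷ xs ++ [ x ]) →
                    (v₀ , u₀) ∈ x ∷ xs → v₀ ≢ r → All (InRow u₀) (x ∷ xs)
  off-spine⇒InRow {x} {xs} {v₀} {u₀} u l p₀∈ v₀≢r = All.tabulate in-row
    where
    in-row? : A × B → Bool
    in-row? p = does (proj₂ p ≟ᴮ u₀)

    leaves-row-only-at-spine : ∀ {p q} → (r , u₀) ≢ p → (r , u₀) ≢ q → CombEdge p q →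
                               in-row? p ≡ in-row? q
    leaves-row-only-at-spine _ _ (tooth _ _) = refl
    leaves-row-only-at-spine {_ , w} {_ , w'} a≢p a≢q (spine _) =
      trans (dec-false (w ≟ᴮ u₀) (a≢p ∘ cong (r ,_) ∘ sym))
            (sym (dec-false (w' ≟ᴮ u₀) (a≢q ∘ cong (r ,_) ∘ sym)))

    in-row : ∀ {p} → p ∈ x ∷ xs → InRow u₀ p
    in-row {p} p∈ with ≡-dec _≟ᴬ_ _≟ᴮ_ (r , u₀) p
    ... | yes refl = refl
    ... | no a≢p = does-true⇒ (proj₂ p ≟ᴮ u₀) (trans
      (≡-on-cycle-minus (≡-dec _≟ᴬ_ _≟ᴮ_) (r , u₀) in-row? leaves-row-only-at-spine
         u l p∈ p₀∈ a≢p (v₀≢r ∘ cong proj₁ ∘ sym))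
      (dec-true (u₀ ≟ᴮ u₀) refl))

  comb-acyclic : Acyclic CombEdge
  comb-acyclic x xs 2≤∣xs∣ u l with all? on-spine? (x ∷ xs)
  ... | yes on-spine =
    Acyclic-pullback proj₂ spine-injective spine-hom (acyclic W) x xs 2≤∣xs∣ u l on-spine
  ... | no ¬on-spine with (v₀ , u₀) , p₀∈ , v₀≢r ← find (¬All⇒Any¬ on-spine? _ ¬on-spine) =
    Acyclic-pullback proj₁ row-injective row-hom (acyclic Z) x xs 2≤∣xs∣ u l
      (off-spine⇒InRow u l p₀∈ v₀≢r)

  comb : Tree (strong G H)
  comb = record
    { verts     = comb-verts
    ; root      = r , root W
    ; root∈     = ∈-cartesianProduct⁺ (root∈ Z) (root∈ W)
    ; distinct  = cartesianProduct⁺ (distinct Z) (distinct W)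
    ; T         = CombEdge
    ; T⊆E       = CombEdge⊆strong
    ; T-sym     = CombEdge-sym
    ; T-verts   = CombEdge-verts
    ; connected = comb-connected
    ; acyclic   = comb-acyclic
    }

module _ {V : Set} {G G' : Graph V} (G⊆G' : G ⊆ᴱ G') where

  Tree-mono : Tree G → Tree G'
  Tree-mono Z = record
    { verts = verts Z ; root = root Z ; root∈ = root∈ Z ; distinct = distinct Z
    ; T = T Z ; T⊆E = G⊆G' ∘ T⊆E Z ; T-sym = T-sym Z ; T-verts = T-verts Z
    ; connected = connected Z ; acyclic = acyclic Z
    }

  HasOddKm-mono : ∀ {m} → HasOddKm G m → HasOddKm G' m
  HasOddKm-mono (Z , c , proper , disjoint , contact) =
    Tree-mono ∘ Z , c , proper , disjoint , contact'
    where
    contact' : Pairwise (OddContact G' c) (Tree-mono ∘ Z)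
    contact' k k' k≢k' with x , y , x∈ , y∈ , e , cx≡cy ← contact k k' k≢k' =
      x , y , x∈ , y∈ , G⊆G' e , cx≡cy

module ProductMinor {A B : Set} (_≟ᴬ_ : DecidableEquality A) (_≟ᴮ_ : DecidableEquality B)
  {G : Graph A} {H : Graph B} {s t : ℕ}
  (Z : Fin s → Tree G) (c : A → Bool) (c-proper : ∀ i → ProperOn c (Z i))
  (Z-disjoint : Pairwise Disjoint Z) (Z-contact : Pairwise (OddContact G c) Z)
  (W : Fin t → Tree H) (d : B → Bool) (d-proper : ∀ j → ProperOn d (W j))
  (W-disjoint : Pairwise Disjoint W) (W-contact : Pairwise (OddContact H d) W) where

  module Y i j = Comb _≟ᴬ_ _≟ᴮ_ (Z i) (W j)

  colour : A × B → Bool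
  colour (v , u) = c v xor d u

  Y-proper : ∀ i j → ProperOn colour (Y.comb i j)
  Y-proper i j (Y.spine e)           = d-proper j e ∘ xor-cancelˡ (c (root (Z i)))
  Y-proper i j (Y.tooth {u = u} _ e) = c-proper i e ∘ xor-cancelʳ (d u)

  Y-disjoint : ∀ {i j i' j'} → (i , j) ≢ (i' , j') → Disjoint (Y.comb i j) (Y.comb i' j')
  Y-disjoint {i} {j} {i'} {j'} ij≢i'j' (v , u) p∈ p∈'
    with v∈ , u∈ ← ∈-cartesianProduct⁻ (verts (Z i)) (verts (W j)) p∈
       | v∈' , u∈' ← ∈-cartesianProduct⁻ (verts (Z i')) (verts (W j')) p∈'
       | i ≟ᶠ i'
  ... | yes refl = W-disjoint j j' (ij≢i'j' ∘ cong (i ,_)) u u∈ u∈'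
  ... | no i≢i'  = Z-disjoint i i' i≢i' v v∈ v∈'

  private
    Contact : Tree (strong G H) → Tree (strong G H) → Set
    Contact = OddContact (strong G H) colour

  row-contact : ∀ {i i'} j → i ≢ i' → Contact (Y.comb i j) (Y.comb i' j)
  row-contact {i} {i'} j i≢i' with x , y , x∈ , y∈ , e , cx≡cy ← Z-contact i i' i≢i' =
    (x , w) , (y , w) ,
    ∈-cartesianProduct⁺ x∈ (root∈ (W j)) , ∈-cartesianProduct⁺ y∈ (root∈ (W j)) ,
    strong-horizontal G H e , cong (_xor d w) cx≡cy
    where
    w : B
    w = root (W j)

  spine-contact : ∀ i {j j'} → j ≢ j' → Contact (Y.comb i j) (Y.comb i j')
  spine-contact i {j} {j'} j≢j' with u , u' , u∈ , u'∈ , e , du≡du' ← W-contact j j' j≢j' =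
    (v , u) , (v , u') ,
    ∈-cartesianProduct⁺ (root∈ (Z i)) u∈ , ∈-cartesianProduct⁺ (root∈ (Z i)) u'∈ ,
    strong-vertical G H e , cong (c v xor_) du≡du'
    where
    v : A
    v = root (Z i)

  diagonal-contact : ∀ {i i' j j'} → i ≢ i' → j ≢ j' → Contact (Y.comb i j) (Y.comb i' j')
  diagonal-contact {i} {i'} {j} {j'} i≢i' j≢j'
    with x , y , x∈ , y∈ , e , cx≡cy ← Z-contact i i' i≢i'
       | u , u' , u∈ , u'∈ , f , du≡du' ← W-contact j j' j≢j' =
    (x , u) , (y , u') , ∈-cartesianProduct⁺ x∈ u∈ , ∈-cartesianProduct⁺ y∈ u'∈ ,
    strong-diagonal G H e f , cong₂ _xor_ cx≡cy du≡du'

  Y-contact : ∀ {i j i' j'} → (i , j) ≢ (i' , j') → Contact (Y.comb i j) (Y.comb i' j')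
  Y-contact {i} {j} {i'} {j'} ij≢i'j' with i ≟ᶠ i' | j ≟ᶠ j'
  ... | yes refl | yes refl = ⊥-elim (ij≢i'j' refl)
  ... | yes refl | no j≢j'  = spine-contact i j≢j'
  ... | no i≢i'  | yes refl = row-contact j i≢i'
  ... | no i≢i'  | no j≢j'  = diagonal-contact i≢i' j≢j'

  index : Fin (s * t) → Fin s × Fin t
  index = remQuot t

  index-injective : ∀ {k k'} → index k ≡ index k' → k ≡ k'
  index-injective {k} {k'} eq = begin
    k                          ≡⟨ combine-remQuot {s} t k ⟨
    uncurry combine (index k)  ≡⟨ cong (uncurry combine) eq ⟩
    uncurry combine (index k') ≡⟨ combine-remQuot {s} t k' ⟩
    k'                         ∎
    where open ≡-Reasoning

  minor : HasOddKm (strong G H) (s * t)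
  minor =
    (λ k → uncurry Y.comb (index k)) , colour ,
    (λ k → uncurry Y-proper (index k)) ,
    (λ k k' k≢k' → Y-disjoint (k≢k' ∘ index-injective)) ,
    (λ k k' k≢k' → Y-contact (k≢k' ∘ index-injective))

strong-HasOddKm : ∀ {A B : Set} → DecidableEquality A → DecidableEquality B →
                  ∀ {G : Graph A} {H : Graph B} {s t} →
                  HasOddKm G s → HasOddKm H t → HasOddKm (strong G H) (s * t)
strong-HasOddKm _≟ᴬ_ _≟ᴮ_ (Z , c , c-proper , Z-disjoint , Z-contact)
                          (W , d , d-proper , W-disjoint , W-contact) =
  ProductMinor.minor _≟ᴬ_ _≟ᴮ_ Z c c-proper Z-disjoint Z-contact W d d-proper W-disjoint W-contact

theorem3 : ∀ (n m : ℕ) (G : Graph (Fin n)) (H : Graph (Fin m)) (s t : ℕ) →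
    IsOh G s → IsOh H t → 2 ≤ s → 2 ≤ t →
    (∀ r → IsOh (lex G H) r → s * t ≤ r) × (∀ r → IsOh (strong G H) r → s * t ≤ r)
theorem3 n m G H s t (G-minor , _) (H-minor , _) _ _ =
  (λ r (_ , maximal) → maximal (s * t) (HasOddKm-mono (strong⊆lex G H) product-minor)) ,
  (λ r (_ , maximal) → maximal (s * t) product-minor)
  where
  product-minor : HasOddKm (strong G H) (s * t)
  product-minor = strong-HasOddKm _≟ᶠ_ _≟ᶠ_ G-minor H-minor
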